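{- Let $Q=(q_n)_{n\ge1}$ be a basic sequence that is infinite in limit, let $F$ be a $Q$-special sequence and let $(a,b,1)\in S_Q$. Then the finite sequence $$y_{F,a,b}=\left(\frac{F_{(a,b,c)}}{q_{\phi_Q(a,b,c)}}\right)_{c=1}^{a}$$ is an almost arithmetic progression-$\left(\frac1a,\frac1a\right)$, and its star discrepancy satisfies $D^*(y_{F,a,b})\le\frac2a$.
   Context: A basic sequence is a sequence $Q=(q_n)_{n\ge1}$ of integers with $q_n\ge 2$; it is infinite in limit if $q_n\to\infty$. For each positive integer $j$ let $\nu_j=\min\{N: q_m\ge 2j^2 \text{ for all } m\ge N\}$. Let $l_1=\max(\nu_2-1,1)$ and, recursively for $i\ge2$, let $l_i$ be the smallest positive integer $k$ with $l_1+2l_2+\cdots+(i-1)l_{i-1}+ik\ge \nu_{i+1}-1$. Put $L_0=0$, $L_i=\sum_{j=1}^i jl_j$. Let $\mathbb N=\{1,2,\dots\}$, $S_Q=\{(a,b,c)\in\mathbb N^3: b\le l_a,\ c\le a\}$ and $\phi_Q(a,b,c)=L_{a-1}+(b-1)a+c$. A $Q$-special sequence is a family of integers $F=(F_{(a,b,c)})_{(a,b,c)\in S_Q}$ with $F_{(a,b,1)}=0$ for all $(a,b,1)\in S_Q$, and $\frac{F_{(a,b,c)}}{q_{\phi_Q(a,b,c)}}\in\left[\frac{c-1}{a}-\frac{1}{2a^2},\frac{c-1}{a}+\frac{1}{2a^2}\right]$ for $(a,b,c)\in S_Q$ with $c>1$. For $0\le\delta<1$ and $\varepsilon>0$, a finite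 sequence $x_1<x_2<\cdots<x_N$ in $[0,1)$ (for $N=1$ just $x_1$) is an almost arithmetic progression-$(\delta,\varepsilon)$ if there is $\eta$ with $0<\eta\le\varepsilon$ such that $0\le x_1\le\eta+\delta\eta$; $\eta-\delta\eta\le x_{n+1}-x_n\le\eta+\delta\eta$ for $1\le n\le N-1$; and $1-\eta-\delta\eta\le x_N<1$. For a finite sequence $z=(z_1,\dots,z_N)$ in $[0,1)$, $D^*(z)=\sup_{0<\gamma\le1}\left|\frac{\#\{k\le N: z_k\in[0,\gamma)\}}{N}-\gamma\right|$.
   Formalization: In the star discrepancy the parameter γ ranges over the rationals in (0,1], and the spacing η of the almost arithmetic progression is taken in the rationals. -}

module Defs where

open import Data.Nat as ℕ using (ℕ; zero; suc; _∸_; _⊔_)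
open import Data.Integer as ℤ using (ℤ; +_)
open import Data.Rational as ℚ using (ℚ; 0ℚ; 1ℚ)
open import Data.Rational.Properties using (_≤?_; _<?_)
open import Data.List using (List; length; filter; map; upTo)
open import Data.Product using (_×_; ∃-syntax)
open import Relation.Nullary.Decidable using (_×-dec_)
open import Relation.Binary.PropositionalEquality using (_≡_)

-- rational number n / d (d is always nonzero where used; value 0 for d = 0)
divℚ : ℤ → ℕ → ℚ
divℚ n zero = 0ℚ
divℚ n (suc d) = n ℚ./ suc d

-- Sequences indexed by positive integers are functions ℕ → ℕ; the value at 0 is ignored.
BasicSeq : (ℕ → ℕ) → Set
BasicSeq q = ∀ n → 1 ℕ.≤ n → 2 ℕ.≤ q n

InfiniteInLimit : (ℕ → ℕ) → Set
InfiniteInLimit q = ∀ M → ∃[ N ] (∀ m → 1 ℕ.≤ m → N ℕ.≤ m → M ℕ.≤ q m)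

IsNu : (ℕ → ℕ) → (ℕ → ℕ) → Set
IsNu q ν = ∀ j → 1 ℕ.≤ j →
    (1 ℕ.≤ ν j)
  × (∀ m → ν j ℕ.≤ m → 2 ℕ.* (j ℕ.* j) ℕ.≤ q m)
  × (∀ N → 1 ℕ.≤ N → (∀ m → N ℕ.≤ m → 2 ℕ.* (j ℕ.* j) ℕ.≤ q m) → ν j ℕ.≤ N)

Lsum : (ℕ → ℕ) → ℕ → ℕ
Lsum l zero = 0
Lsum l (suc i) = Lsum l i ℕ.+ suc i ℕ.* l (suc i)

IsL : (ℕ → ℕ) → (ℕ → ℕ) → Set
IsL ν l =
    (l 1 ≡ (ν 2 ∸ 1) ⊔ 1)
  × (∀ i → 2 ℕ.≤ i →
        (1 ℕ.≤ l i)
      × (ν (suc i) ∸ 1 ℕ.≤ Lsum l (i ∸ 1) ℕ.+ i ℕ.* l i)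
      × (∀ k → 1 ℕ.≤ k → ν (suc i) ∸ 1 ℕ.≤ Lsum l (i ∸ 1) ℕ.+ i ℕ.* k → l i ℕ.≤ k))

InS : (ℕ → ℕ) → ℕ → ℕ → ℕ → Set
InS l a b c = (1 ℕ.≤ a) × (1 ℕ.≤ b) × (1 ℕ.≤ c) × (b ℕ.≤ l a) × (c ℕ.≤ a)

φ : (ℕ → ℕ) → ℕ → ℕ → ℕ → ℕ
φ l a b c = Lsum l (a ∸ 1) ℕ.+ (b ∸ 1) ℕ.* a ℕ.+ c

yval : (ℕ → ℕ) → (ℕ → ℕ) → (ℕ → ℕ → ℕ → ℤ) → ℕ → ℕ → ℕ → ℚ
yval q l F a b c = divℚ (F a b c) (q (φ l a b c))

Special : (ℕ → ℕ) → (ℕ → ℕ) → (ℕ → ℕ → ℕ → ℤ) → Set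
Special q l F = ∀ a b c → InS l a b c →
    (c ≡ 1 → F a b c ≡ + 0)
  × (1 ℕ.< c →
        (divℚ (+ (c ∸ 1)) a ℚ.- divℚ (+ 1) (2 ℕ.* (a ℕ.* a)) ℚ.≤ yval q l F a b c)
      × (yval q l F a b c ℚ.≤ divℚ (+ (c ∸ 1)) a ℚ.+ divℚ (+ 1) (2 ℕ.* (a ℕ.* a))))

AlmostAP : (ℕ → ℚ) → ℕ → ℚ → ℚ → Set
AlmostAP x N δ ε =
    (∀ n → 1 ℕ.≤ n → n ℕ.≤ N → (0ℚ ℚ.≤ x n) × (x n ℚ.< 1ℚ))
  × (∀ n → 1 ℕ.≤ n → n ℕ.< N → x n ℚ.< x (suc n))
  × ∃[ η ] ( (0ℚ ℚ.< η) × (η ℚ.≤ ε)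
           × (0ℚ ℚ.≤ x 1) × (x 1 ℚ.≤ η ℚ.+ δ ℚ.* η)
           × (∀ n → 1 ℕ.≤ n → n ℕ.< N →
                 (η ℚ.- δ ℚ.* η ℚ.≤ x (suc n) ℚ.- x n)
               × (x (suc n) ℚ.- x n ℚ.≤ η ℚ.+ δ ℚ.* η))
           × (1ℚ ℚ.- η ℚ.- δ ℚ.* η ℚ.≤ x N) × (x N ℚ.< 1ℚ))

countBelow : (ℕ → ℚ) → ℕ → ℚ → ℕ
countBelow z N γ =
  length (filter (λ k → (0ℚ ≤? z k) ×-dec (z k <? γ)) (map suc (upTo N)))

-- D*(z_1..z_N) ≤ B  (supremum over γ ∈ (0,1], taken over rational γ)
StarDiscrepancyLe : (ℕ → ℚ) → ℕ → ℚ → Set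
StarDiscrepancyLe z N B = ∀ γ → 0ℚ ℚ.< γ → γ ℚ.≤ 1ℚ →
  ℚ.∣ divℚ (+ countBelow z N γ) N ℚ.- γ ∣ ℚ.≤ B

{-# OPTIONS --safe #-}
-- Write a = suc d, h = 1/(2a²) and t k = k/a. A special sequence puts its c-th point within h
-- of the grid point t (c - 1), and the first point exactly at 0. Since 2h = 1/a², neighbouring
-- points are 1/a ± 1/a² apart, which is the almost arithmetic progression with η = δ = 1/a.
-- For the discrepancy, if m points lie below γ then one of them has index at least m, so
-- t m - γ ≤ 1/a + h; and if m < a some point of index at most m + 1 is not below γ, so
-- γ - t m ≤ h. Both bounds are at most 2/a.
module Submission where

open import Defs
open import Data.Nat as ℕ using (ℕ; zero; suc; z≤n; s≤s)
import Data.Nat.Properties as ℕP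
import Data.Nat.Solver as ℕSolver
open import Data.Integer as ℤ using (ℤ; +_)
import Data.Integer.Properties as ℤP
open import Data.Product using (_×_; _,_; proj₁; proj₂; ∃-syntax)
open import Data.Sum using (_⊎_; inj₁; inj₂)
open import Relation.Nullary using (¬_; yes; no)
open import Relation.Unary using (Decidable)
open import Relation.Binary.PropositionalEquality hiding ([_])

module Counting {P : ℕ → Set} (P? : Decidable P) where
  open import Data.Nat
  open import Data.Nat.Properties
  open import Data.List using ([]; length; filter; map; upTo; _++_; [_])
  open import Data.List.Properties using (upTo-∷ʳ; map-++; filter-++; length-++; filter-accept; filter-reject)
  open ≡-Reasoning

  count : ℕ → ℕ
  count n = length (filter P? (map suc (upTo n)))

  count-suc : ∀ n → count (suc n) ≡ count n + length (filter P? [ suc n ])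
  count-suc n = begin
      length (filter P? (map suc (upTo (suc n))))
    ≡⟨ cong (λ l → length (filter P? (map suc l))) (sym (upTo-∷ʳ n)) ⟩
      length (filter P? (map suc (upTo n ++ [ n ])))
    ≡⟨ cong (λ l → length (filter P? l)) (map-++ suc (upTo n) [ n ]) ⟩
      length (filter P? (map suc (upTo n) ++ [ suc n ]))
    ≡⟨ cong length (filter-++ P? (map suc (upTo n)) [ suc n ]) ⟩
      length (filter P? (map suc (upTo n)) ++ filter P? [ suc n ])
    ≡⟨ length-++ (filter P? (map suc (upTo n))) ⟩
      count n + length (filter P? [ suc n ]) ∎

  count-accept : ∀ n → P (suc n) → count (suc n) ≡ suc (count n)
  count-accept n p rewrite count-suc n | filter-accept P? {xs = []} p = +-comm (count n) 1

  count-reject : ∀ n → ¬ P (suc n) → count (suc n) ≡ count n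
  count-reject n ¬p rewrite count-suc n | filter-reject P? {xs = []} ¬p = +-identityʳ (count n)

  count≤n : ∀ n → count n ≤ n
  count≤n zero = z≤n
  count≤n (suc n) with P? (suc n)
  ... | yes p rewrite count-accept n p = s≤s (count≤n n)
  ... | no ¬p rewrite count-reject n ¬p = m≤n⇒m≤1+n (count≤n n)

  count≡0⊎count≤accepted : ∀ n →
    count n ≡ 0 ⊎ ∃[ k ] (suc k ≤ n × P (suc k) × count n ≤ suc k)
  count≡0⊎count≤accepted zero = inj₁ refl
  count≡0⊎count≤accepted (suc n) with P? (suc n)
  ... | yes p rewrite count-accept n p = inj₂ (n , ≤-refl , p , s≤s (count≤n n))
  ... | no ¬p rewrite count-reject n ¬p with count≡0⊎count≤accepted n
  ...   | inj₁ c≡0 = inj₁ c≡0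
  ...   | inj₂ (k , k<n , pk , c≤k) = inj₂ (k , m≤n⇒m≤1+n k<n , pk , c≤k)

  count≡n⊎rejected≤1+count : ∀ n →
    count n ≡ n ⊎ ∃[ k ] (suc k ≤ n × ¬ P (suc k) × k ≤ count n)
  count≡n⊎rejected≤1+count zero = inj₁ refl
  count≡n⊎rejected≤1+count (suc n) with P? (suc n) | count≡n⊎rejected≤1+count n
  ... | yes p  | inj₁ c≡n rewrite count-accept n p = inj₁ (cong suc c≡n)
  ... | no ¬p  | inj₁ c≡n rewrite count-reject n ¬p = inj₂ (n , ≤-refl , ¬p , ≤-reflexive (sym c≡n))
  ... | yes p  | inj₂ (k , k<n , ¬pk , k≤c) rewrite count-accept n p =
    inj₂ (k , m≤n⇒m≤1+n k<n , ¬pk , m≤n⇒m≤1+n k≤c)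
  ... | no ¬p  | inj₂ (k , k<n , ¬pk , k≤c) rewrite count-reject n ¬p =
    inj₂ (k , m≤n⇒m≤1+n k<n , ¬pk , k≤c)

open import Data.Rational as ℚ using (ℚ; 0ℚ; 1ℚ; _≤_; _<_; _+_; _-_; _*_; -_; toℚᵘ)
import Data.Rational.Properties as ℚP
open import Data.Rational.Properties using (_≤?_; _<?_)
import Data.Rational.Solver as ℚSolver
open import Data.Rational.Unnormalised as ℚᵘ using (mkℚᵘ; *≡*) renaming (_≃_ to _≃ᵘ_)
import Data.Rational.Unnormalised.Properties as ℚᵘP
open import Relation.Nullary.Decidable using (_×-dec_)

divℚ-zero : ∀ n → divℚ (+ 0) n ≡ 0ℚ
divℚ-zero zero = refl
divℚ-zero (suc n) = ℚP.0/n≡0 (suc n)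

toℚᵘ-divℚ : ∀ n d → toℚᵘ (divℚ (+ n) (suc d)) ≃ᵘ mkℚᵘ (+ n) d
toℚᵘ-divℚ n d = ℚP.toℚᵘ-fromℚᵘ (mkℚᵘ (+ n) d)

[m*D+n*D]*D≡[m+n]*D² : ∀ m n D →
  (+ m ℤ.* + D ℤ.+ + n ℤ.* + D) ℤ.* + D ≡ + (m ℕ.+ n) ℤ.* + (D ℕ.* D)
[m*D+n*D]*D≡[m+n]*D² m n D = begin
    (+ m ℤ.* + D ℤ.+ + n ℤ.* + D) ℤ.* + D  ≡⟨ cong₂ (λ u v → (u ℤ.+ v) ℤ.* + D) (sym (ℤP.pos-* m D)) (sym (ℤP.pos-* n D)) ⟩
    + (m ℕ.* D ℕ.+ n ℕ.* D) ℤ.* + D         ≡⟨ sym (ℤP.pos-* (m ℕ.* D ℕ.+ n ℕ.* D) D) ⟩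
    + ((m ℕ.* D ℕ.+ n ℕ.* D) ℕ.* D)         ≡⟨ cong +_ (solve 3 (λ M N X → (M :* X :+ N :* X) :* X := (M :+ N) :* (X :* X)) refl m n D) ⟩
    + ((m ℕ.+ n) ℕ.* (D ℕ.* D))             ≡⟨ ℤP.pos-* (m ℕ.+ n) (D ℕ.* D) ⟩
    + (m ℕ.+ n) ℤ.* + (D ℕ.* D)             ∎
  where
  open ≡-Reasoning
  open ℕSolver.+-*-Solver

[2D²+2D²]*D²≡[2D²]² : ∀ D → let N = 2 ℕ.* (D ℕ.* D) in
  (+ 1 ℤ.* + N ℤ.+ + 1 ℤ.* + N) ℤ.* + (D ℕ.* D) ≡ (+ 1 ℤ.* + 1) ℤ.* + (N ℕ.* N)
[2D²+2D²]*D²≡[2D²]² D = begin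
    (+ 1 ℤ.* + N ℤ.+ + 1 ℤ.* + N) ℤ.* + (D ℕ.* D) ≡⟨ cong (λ x → (x ℤ.+ x) ℤ.* + (D ℕ.* D)) (ℤP.*-identityˡ (+ N)) ⟩
    + (N ℕ.+ N) ℤ.* + (D ℕ.* D)                   ≡⟨ sym (ℤP.pos-* (N ℕ.+ N) (D ℕ.* D)) ⟩
    + ((N ℕ.+ N) ℕ.* (D ℕ.* D))                   ≡⟨ cong +_ (solve 1 (λ X → (con 2 :* (X :* X) :+ con 2 :* (X :* X)) :* (X :* X)
                                                        := (con 2 :* (X :* X)) :* (con 2 :* (X :* X))) refl D) ⟩
    + (N ℕ.* N)                                   ≡⟨ sym (ℤP.*-identityˡ (+ (N ℕ.* N))) ⟩
    (+ 1 ℤ.* + 1) ℤ.* + (N ℕ.* N)                 ∎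
  where
  open ≡-Reasoning
  open ℕSolver.+-*-Solver
  N : ℕ
  N = 2 ℕ.* (D ℕ.* D)

divℚ-+ : ∀ m n d → divℚ (+ (m ℕ.+ n)) (suc d) ≡ divℚ (+ m) (suc d) + divℚ (+ n) (suc d)
divℚ-+ m n d = ℚP.toℚᵘ-injective (begin
    toℚᵘ (divℚ (+ (m ℕ.+ n)) D)                    ≈⟨ toℚᵘ-divℚ (m ℕ.+ n) d ⟩
    mkℚᵘ (+ (m ℕ.+ n)) d                           ≈⟨ *≡* (sym ([m*D+n*D]*D≡[m+n]*D² m n D)) ⟩
    mkℚᵘ (+ m) d ℚᵘ.+ mkℚᵘ (+ n) d                 ≈⟨ ℚᵘP.≃-sym (ℚᵘP.+-cong (toℚᵘ-divℚ m d) (toℚᵘ-divℚ n d)) ⟩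
    toℚᵘ (divℚ (+ m) D) ℚᵘ.+ toℚᵘ (divℚ (+ n) D)   ≈⟨ ℚᵘP.≃-sym (ℚP.toℚᵘ-homo-+ (divℚ (+ m) D) (divℚ (+ n) D)) ⟩
    toℚᵘ (divℚ (+ m) D + divℚ (+ n) D)              ∎)
  where
  open ℚᵘP.≃-Reasoning
  D : ℕ
  D = suc d

divℚ-self : ∀ d → divℚ (+ suc d) (suc d) ≡ 1ℚ
divℚ-self d = ℚP.toℚᵘ-injective (ℚᵘP.≃-trans (toℚᵘ-divℚ (suc d) d)
  (*≡* (trans (ℤP.*-identityʳ (+ suc d)) (sym (ℤP.*-identityˡ (+ suc d))))))

1/2n²+1/2n²≡1/n*1/n : ∀ d → let h = divℚ (+ 1) (2 ℕ.* (suc d ℕ.* suc d)); e = divℚ (+ 1) (suc d) in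
  h + h ≡ e * e
1/2n²+1/2n²≡1/n*1/n d = ℚP.toℚᵘ-injective (begin
    toℚᵘ (h + h)                       ≈⟨ ℚP.toℚᵘ-homo-+ h h ⟩
    toℚᵘ h ℚᵘ.+ toℚᵘ h                 ≈⟨ ℚᵘP.+-cong (toℚᵘ-divℚ 1 (ℕ.pred N)) (toℚᵘ-divℚ 1 (ℕ.pred N)) ⟩
    mkℚᵘ (+ 1) (ℕ.pred N) ℚᵘ.+ mkℚᵘ (+ 1) (ℕ.pred N) ≈⟨ *≡* ([2D²+2D²]*D²≡[2D²]² D) ⟩
    mkℚᵘ (+ 1) d ℚᵘ.* mkℚᵘ (+ 1) d     ≈⟨ ℚᵘP.≃-sym (ℚᵘP.*-cong (toℚᵘ-divℚ 1 d) (toℚᵘ-divℚ 1 d)) ⟩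
    toℚᵘ e ℚᵘ.* toℚᵘ e                 ≈⟨ ℚᵘP.≃-sym (ℚP.toℚᵘ-homo-* e e) ⟩
    toℚᵘ (e * e)                       ∎)
  where
  open ℚᵘP.≃-Reasoning
  D N : ℕ
  D = suc d
  N = 2 ℕ.* (D ℕ.* D)
  h e : ℚ
  h = divℚ (+ 1) N
  e = divℚ (+ 1) D

x+[y-x]≡y : ∀ x y → x + (y - x) ≡ y
x+[y-x]≡y = solve 2 (λ x y → x :+ (y :- x) := y) refl
  where open ℚSolver.+-*-Solver

-- Every inequality below is reduced, by the field solver, to the nonnegativity of a sum of
-- differences already known to be nonnegative.
≤-byDifference : ∀ {x y} s → y - x ≡ s → 0ℚ ≤ s → x ≤ y
≤-byDifference {x} {y} s y-x≡s 0≤s = subst₂ _≤_ (ℚP.+-identityʳ x) (x+[y-x]≡y x y)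
  (ℚP.+-monoʳ-≤ x (subst (0ℚ ≤_) (sym y-x≡s) 0≤s))

<-byDifference : ∀ {x y} s → y - x ≡ s → 0ℚ < s → x < y
<-byDifference {x} {y} s y-x≡s 0<s = subst₂ _<_ (ℚP.+-identityʳ x) (x+[y-x]≡y x y)
  (ℚP.+-monoʳ-< x (subst (0ℚ <_) (sym y-x≡s) 0<s))

≤⇒0≤difference : ∀ {x y} → x ≤ y → 0ℚ ≤ y - x
≤⇒0≤difference {x} {y} x≤y = subst (_≤ y - x) (ℚP.+-inverseʳ x) (ℚP.+-monoˡ-≤ (- x) x≤y)

<⇒0<difference : ∀ {x y} → x < y → 0ℚ < y - x
<⇒0<difference {x} {y} x<y = subst (_< y - x) (ℚP.+-inverseʳ x) (ℚP.+-monoˡ-< (- x) x<y)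

0≤+ : ∀ {x y} → 0ℚ ≤ x → 0ℚ ≤ y → 0ℚ ≤ x + y
0≤+ = ℚP.+-mono-≤

0<+ : ∀ {x y} → 0ℚ ≤ x → 0ℚ < y → 0ℚ < x + y
0<+ = ℚP.+-mono-≤-<

0<* : ∀ {x y} → 0ℚ < x → 0ℚ < y → 0ℚ < x * y
0<* {x} {y} 0<x 0<y = subst (_< x * y) (ℚP.*-zeroˡ y) (ℚP.*-monoˡ-<-pos y {{ℚ.positive 0<y}} 0<x)

∣x∣≤b : ∀ {x b} → x ≤ b → - x ≤ b → ℚ.∣ x ∣ ≤ b
∣x∣≤b {x} x≤b -x≤b with ℚP.∣p∣≡p∨∣p∣≡-p x
... | inj₁ ∣x∣≡x  = subst (_≤ _) (sym ∣x∣≡x) x≤b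
... | inj₂ ∣x∣≡-x = subst (_≤ _) (sym ∣x∣≡-x) -x≤b

module Grid (d : ℕ) where
  open ℚSolver.+-*-Solver

  a : ℕ
  a = suc d

  e h : ℚ
  e = divℚ (+ 1) a
  h = divℚ (+ 1) (2 ℕ.* (a ℕ.* a))

  t : ℕ → ℚ
  t k = divℚ (+ k) a

  t-suc : ∀ k → t (suc k) ≡ e + t k
  t-suc k = divℚ-+ 1 k d

  t-zero : t 0 ≡ 0ℚ
  t-zero = divℚ-zero a

  t-a : t a ≡ 1ℚ
  t-a = divℚ-self d

  t-two : t 2 ≡ e + e
  t-two = trans (t-suc 1) (cong (λ w → e + w) (trans (t-suc 0) (trans (cong (λ w → e + w) t-zero) (ℚP.+-identityʳ e))))

  e+t[d]≡1 : e + t d ≡ 1ℚ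
  e+t[d]≡1 = trans (sym (t-suc d)) t-a

  0≤t : ∀ k → 0ℚ ≤ t k
  0≤t k = ℚP.nonNegative⁻¹ (t k) {{ℚP.normalize-nonNeg k a}}

  0<e : 0ℚ < e
  0<e = ℚP.positive⁻¹ e {{ℚP.normalize-pos 1 a}}

  0<h : 0ℚ < h
  0<h = ℚP.positive⁻¹ h {{ℚP.normalize-pos 1 (2 ℕ.* (a ℕ.* a))}}

  0≤h : 0ℚ ≤ h
  0≤h = ℚP.<⇒≤ 0<h

  e*e≡h+h : e * e ≡ h + h
  e*e≡h+h = sym (1/2n²+1/2n²≡1/n*1/n d)

  t-mono : ∀ {m n} → m ℕ.≤ n → t m ≤ t n
  t-mono {m} {n} m≤n = subst (λ w → t m ≤ t w) (ℕP.m+[n∸m]≡n m≤n)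
    (subst (t m ≤_) (sym (divℚ-+ m (n ℕ.∸ m) d))
      (≤-byDifference (t (n ℕ.∸ m)) (solve 2 (λ x y → (x :+ y) :- x := y) refl (t m) (t (n ℕ.∸ m))) (0≤t (n ℕ.∸ m))))

  e≤1 : e ≤ 1ℚ
  e≤1 = subst (e ≤_) t-a (t-mono {1} {a} (s≤s z≤n))

  0≤e-2h : 0ℚ ≤ e - (h + h)
  0≤e-2h = subst (λ w → 0ℚ ≤ e - w) e*e≡h+h (≤⇒0≤difference (subst (e * e ≤_) (ℚP.*-identityʳ e)
    (ℚP.*-monoˡ-≤-nonNeg e {{ℚ.nonNegative (ℚP.<⇒≤ 0<e)}} e≤1)))

  -- 1/a - 1/a² = (1/a)(1 - 1/a), and 1 - 1/a ≥ 1/a because 2/a ≤ 1.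
  0<e-2h : 2 ℕ.≤ a → 0ℚ < e - (h + h)
  0<e-2h 2≤a = subst (λ w → 0ℚ < e - w) e*e≡h+h
    (subst (0ℚ <_) (solve 1 (λ E → E :* (con 1ℚ :- E) := E :- E :* E) refl e)
      (0<* 0<e (<-byDifference ((1ℚ - (e + e)) + e)
        (solve 1 (λ E → (con 1ℚ :- E) :- con 0ℚ := (con 1ℚ :- (E :+ E)) :+ E) refl e)
        (0<+ (≤⇒0≤difference (subst₂ _≤_ t-two t-a (t-mono 2≤a))) 0<e))))

  module NearGrid (y : ℕ → ℚ) (y₁≡0 : y 1 ≡ 0ℚ)
    (near : ∀ c → 1 ℕ.< c → c ℕ.≤ a → (t (c ℕ.∸ 1) - h ≤ y c) × (y c ≤ t (c ℕ.∸ 1) + h)) where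

    t-h≤y : ∀ k → suc k ℕ.≤ a → t k - h ≤ y (suc k)
    t-h≤y zero _ = subst₂ (λ u w → u - h ≤ w) (sym t-zero) (sym y₁≡0)
      (≤-byDifference h (solve 1 (λ H → con 0ℚ :- (con 0ℚ :- H) := H) refl h) 0≤h)
    t-h≤y (suc j) k<a = proj₁ (near (suc (suc j)) (s≤s (s≤s z≤n)) k<a)

    y≤t+h : ∀ k → suc k ℕ.≤ a → y (suc k) ≤ t k + h
    y≤t+h zero _ = subst₂ (λ u w → w ≤ u + h) (sym t-zero) (sym y₁≡0)
      (≤-byDifference h (solve 1 (λ H → (con 0ℚ :+ H) :- con 0ℚ := H) refl h) 0≤h)
    y≤t+h (suc j) k<a = proj₂ (near (suc (suc j)) (s≤s (s≤s z≤n)) k<a)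

    0≤y : ∀ k → suc k ℕ.≤ a → 0ℚ ≤ y (suc k)
    0≤y zero _ = ℚP.≤-reflexive (sym y₁≡0)
    0≤y (suc j) k<a = ℚP.≤-trans 0≤t[1+j]-h (t-h≤y (suc j) k<a)
      where
      0≤t[1+j]-h : 0ℚ ≤ t (suc j) - h
      0≤t[1+j]-h = subst (λ w → 0ℚ ≤ w - h) (sym (t-suc j))
        (subst (0ℚ ≤_) (solve 3 (λ E H T → (E :- (H :+ H)) :+ H :+ T := (E :+ T) :- H) refl e h (t j))
          (0≤+ (0≤+ 0≤e-2h 0≤h) (0≤t j)))

    y<1 : ∀ k → suc k ℕ.≤ a → y (suc k) < 1ℚ
    y<1 k k<a = ℚP.≤-<-trans (y≤t+h k k<a) (ℚP.≤-<-trans (ℚP.+-monoˡ-≤ h (t-mono (ℕP.≤-pred k<a))) t[d]+h<1)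
      where
      t[d]+h<1 : t d + h < 1ℚ
      t[d]+h<1 = subst (t d + h <_) e+t[d]≡1 (<-byDifference ((e - (h + h)) + h)
        (solve 3 (λ E H T → (E :+ T) :- (T :+ H) := (E :- (H :+ H)) :+ H) refl e h (t d))
        (0<+ 0≤e-2h 0<h))

    y-increasing : ∀ k → suc (suc k) ℕ.≤ a → y (suc k) < y (suc (suc k))
    y-increasing k k+1<a = ℚP.≤-<-trans (y≤t+h k (ℕP.<⇒≤ k+1<a))
      (ℚP.<-≤-trans gap (t-h≤y (suc k) k+1<a))
      where
      gap : t k + h < t (suc k) - h
      gap = subst (λ w → t k + h < w - h) (sym (t-suc k))
        (<-byDifference (e - (h + h)) (solve 3 (λ E H T → ((E :+ T) :- H) :- (T :+ H) := E :- (H :+ H)) refl e h (t k))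
          (0<e-2h (ℕP.≤-trans (s≤s (s≤s z≤n)) k+1<a)))

    e-e*e≤gap : ∀ k → suc (suc k) ℕ.≤ a → e - e * e ≤ y (suc (suc k)) - y (suc k)
    e-e*e≤gap k k+1<a = subst (λ w → e - w ≤ y₂ - y₁) (sym e*e≡h+h)
      (≤-byDifference ((y₂ - ((e + t k) - h)) + ((t k + h) - y₁))
        (solve 5 (λ Y₂ Y₁ E H T → (Y₂ :- Y₁) :- (E :- (H :+ H)) := (Y₂ :- ((E :+ T) :- H)) :+ ((T :+ H) :- Y₁))
          refl y₂ y₁ e h (t k))
        (0≤+ (subst (λ w → 0ℚ ≤ y₂ - (w - h)) (t-suc k) (≤⇒0≤difference (t-h≤y (suc k) k+1<a)))
             (≤⇒0≤difference (y≤t+h k (ℕP.<⇒≤ k+1<a)))))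
      where
      y₁ y₂ : ℚ
      y₁ = y (suc k)
      y₂ = y (suc (suc k))

    gap≤e+e*e : ∀ k → suc (suc k) ℕ.≤ a → y (suc (suc k)) - y (suc k) ≤ e + e * e
    gap≤e+e*e k k+1<a = subst (λ w → y₂ - y₁ ≤ e + w) (sym e*e≡h+h)
      (≤-byDifference ((((e + t k) + h) - y₂) + (y₁ - (t k - h)))
        (solve 5 (λ Y₂ Y₁ E H T → (E :+ (H :+ H)) :- (Y₂ :- Y₁) := (((E :+ T) :+ H) :- Y₂) :+ (Y₁ :- (T :- H)))
          refl y₂ y₁ e h (t k))
        (0≤+ (subst (λ w → 0ℚ ≤ (w + h) - y₂) (t-suc k) (≤⇒0≤difference (y≤t+h (suc k) k+1<a)))
             (≤⇒0≤difference (t-h≤y k (ℕP.<⇒≤ k+1<a)))))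
      where
      y₁ y₂ : ℚ
      y₁ = y (suc k)
      y₂ = y (suc (suc k))

    y₁≤e+e*e : y 1 ≤ e + e * e
    y₁≤e+e*e = subst (_≤ e + e * e) (sym y₁≡0)
      (ℚP.≤-trans (ℚP.<⇒≤ 0<e) (≤-byDifference (e * e) (solve 1 (λ E → (E :+ E :* E) :- E := E :* E) refl e)
        (subst (0ℚ ≤_) (sym e*e≡h+h) (0≤+ 0≤h 0≤h))))

    1-e-e*e≤y[a] : 1ℚ - e - e * e ≤ y a
    1-e-e*e≤y[a] = subst₂ (λ u w → u - e - w ≤ y a) e+t[d]≡1 (sym e*e≡h+h)
      (≤-byDifference ((y a - (t d - h)) + h)
        (solve 4 (λ Y E H T → Y :- (((E :+ T) :- E) :- (H :+ H)) := (Y :- (T :- H)) :+ H) refl (y a) e h (t d))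
        (0≤+ (≤⇒0≤difference (t-h≤y d ℕP.≤-refl)) 0≤h))

    almostAP : AlmostAP y a e e
    almostAP = inRange , increasing ,
      (e , 0<e , ℚP.≤-refl , 0≤y 0 (s≤s z≤n) , y₁≤e+e*e , gaps , 1-e-e*e≤y[a] , y<1 d ℕP.≤-refl)
      where
      inRange : ∀ n → 1 ℕ.≤ n → n ℕ.≤ a → (0ℚ ≤ y n) × (y n < 1ℚ)
      inRange (suc k) _ k<a = 0≤y k k<a , y<1 k k<a
      increasing : ∀ n → 1 ℕ.≤ n → n ℕ.< a → y n < y (suc n)
      increasing (suc k) _ = y-increasing k
      gaps : ∀ n → 1 ℕ.≤ n → n ℕ.< a → (e - e * e ≤ y (suc n) - y n) × (y (suc n) - y n ≤ e + e * e)
      gaps (suc k) _ k+1<a = e-e*e≤gap k k+1<a , gap≤e+e*e k k+1<a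

    excess≤2/a : ∀ γ m → 0ℚ < γ →
      m ≡ 0 ⊎ ∃[ k ] (suc k ℕ.≤ a × ((0ℚ ≤ y (suc k)) × (y (suc k) < γ)) × m ℕ.≤ suc k) →
      t m - γ ≤ t 2
    excess≤2/a γ .0 0<γ (inj₁ refl) = subst (λ w → w - γ ≤ t 2) (sym t-zero)
      (≤-byDifference (t 2 + γ) (solve 2 (λ T G → T :- (con 0ℚ :- G) := T :+ G) refl (t 2) γ)
        (0≤+ (0≤t 2) (ℚP.<⇒≤ 0<γ)))
    excess≤2/a γ m 0<γ (inj₂ (k , k<a , (_ , yk<γ) , m≤k+1)) = subst (λ w → t m - γ ≤ w) (sym t-two)
      (≤-byDifference ((((e + t k) - t m) + (γ - y (suc k))) + ((y (suc k) - (t k - h)) + ((e - (h + h)) + h)))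
        (solve 6 (λ E H T C G Y → (E :+ E) :- (C :- G) :=
            (((E :+ T) :- C) :+ (G :- Y)) :+ ((Y :- (T :- H)) :+ ((E :- (H :+ H)) :+ H)))
          refl e h (t k) (t m) γ (y (suc k)))
        (0≤+ (0≤+ (subst (λ w → 0ℚ ≤ w - t m) (t-suc k) (≤⇒0≤difference (t-mono m≤k+1)))
                  (ℚP.<⇒≤ (<⇒0<difference yk<γ)))
             (0≤+ (≤⇒0≤difference (t-h≤y k k<a)) (0≤+ 0≤e-2h 0≤h))))

    deficit≤2/a : ∀ γ m → γ ≤ 1ℚ →
      m ≡ a ⊎ ∃[ k ] (suc k ℕ.≤ a × ¬ ((0ℚ ≤ y (suc k)) × (y (suc k) < γ)) × k ℕ.≤ m) →
      - (t m - γ) ≤ t 2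
    deficit≤2/a γ .a γ≤1 (inj₁ refl) = subst (λ w → - (w - γ) ≤ t 2) (sym t-a)
      (≤-byDifference ((1ℚ - γ) + t 2) (solve 2 (λ T G → T :- (:- (con 1ℚ :- G)) := (con 1ℚ :- G) :+ T) refl (t 2) γ)
        (0≤+ (≤⇒0≤difference γ≤1) (0≤t 2)))
    deficit≤2/a γ m γ≤1 (inj₂ (k , k<a , yk≮γ , k≤m)) = subst (λ w → - (t m - γ) ≤ w) (sym t-two)
      (≤-byDifference ((((t m - t k) + (y (suc k) - γ)) + ((t k + h) - y (suc k))) + (((e - (h + h)) + h) + e))
        (solve 6 (λ E H T C G Y → (E :+ E) :- (:- (C :- G)) :=
            (((C :- T) :+ (Y :- G)) :+ ((T :+ H) :- Y)) :+ (((E :- (H :+ H)) :+ H) :+ E))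
          refl e h (t k) (t m) γ (y (suc k)))
        (0≤+ (0≤+ (0≤+ (≤⇒0≤difference (t-mono k≤m)) (≤⇒0≤difference γ≤yk)) (≤⇒0≤difference (y≤t+h k k<a)))
             (0≤+ (0≤+ 0≤e-2h 0≤h) (ℚP.<⇒≤ 0<e))))
      where
      γ≤yk : γ ≤ y (suc k)
      γ≤yk = ℚP.≮⇒≥ (λ yk<γ → yk≮γ (0≤y k k<a , yk<γ))

    starDiscrepancy≤2/a : StarDiscrepancyLe y a (t 2)
    starDiscrepancy≤2/a γ 0<γ γ≤1 = ∣x∣≤b
      (excess≤2/a γ (count a) 0<γ (count≡0⊎count≤accepted a))
      (deficit≤2/a γ (count a) γ≤1 (count≡n⊎rejected≤1+count a))
      where open Counting (λ k → (0ℚ ≤? y k) ×-dec (y k <? γ))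

mainTheorem13 : (q : ℕ → ℕ) → BasicSeq q → InfiniteInLimit q →
    (ν : ℕ → ℕ) → IsNu q ν → (l : ℕ → ℕ) → IsL ν l →
    (F : ℕ → ℕ → ℕ → ℤ) → Special q l F →
    (a b : ℕ) → InS l a b 1 →
      AlmostAP (yval q l F a b) a (divℚ (+ 1) a) (divℚ (+ 1) a)
    × StarDiscrepancyLe (yval q l F a b) a (divℚ (+ 2) a)
mainTheorem13 q _ _ _ _ l _ F special zero b (() , _)
mainTheorem13 q _ _ _ _ l _ F special (suc d) b inS@(1≤a , 1≤b , _ , b≤l , _) = almostAP , starDiscrepancy≤2/a
  where
  open Grid d

  y : ℕ → ℚ
  y = yval q l F a b

  y₁≡0 : y 1 ≡ 0ℚ
  y₁≡0 = trans (cong (λ z → divℚ z (q (φ l a b 1))) (proj₁ (special a b 1 inS) refl)) (divℚ-zero (q (φ l a b 1)))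

  near : ∀ c → 1 ℕ.< c → c ℕ.≤ a → (t (c ℕ.∸ 1) - h ≤ y c) × (y c ≤ t (c ℕ.∸ 1) + h)
  near c 1<c c≤a = proj₂ (special a b c (1≤a , 1≤b , ℕP.<⇒≤ 1<c , b≤l , c≤a)) 1<c

  open NearGrid y y₁≡0 near
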